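{- Let $T$ be a tree with at least $3$ vertices such that $\Psi(T)=\Psi(T-x)$ for every leaf $x$ of $T$. Then the number of vertices of $T$ is even.
   Context: A matching of a graph is a set of edges no two of which share a vertex; it is maximal if it is not properly contained in another matching. $\Psi(G)$ denotes the number of maximal matchings of $G$. A leaf is a vertex of degree $1$. -}

module Defs where

open import Data.Nat using (ℕ; zero; suc; _<_; _≤_; _≤ᵇ_)
open import Data.Bool using (Bool; true; false; _∧_; _∨_; not; if_then_else_)
open import Data.Fin using (Fin; toℕ; punchIn; _≟_)
open import Data.List using (List; []; _∷_; length; filterᵇ; concatMap; map; last; _++_)
open import Data.Bool.ListAction using (all; any)
open import Data.Unit using (⊤)
open import Data.Empty using (⊥)
open import Data.List.Relation.Unary.Unique.Propositional using (Unique)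
open import Data.Maybe using (Maybe; just; nothing)
open import Data.Product using (_×_; _,_; Σ; ∃; proj₁; proj₂)
open import Relation.Nullary using (¬_; does)
open import Relation.Binary.PropositionalEquality using (_≡_)
open import Data.List using (allFin)

record Graph (n : ℕ) : Set where
  field
    adj   : Fin n → Fin n → Bool
    sym   : ∀ i j → adj i j ≡ adj j i
    irrefl : ∀ i → adj i i ≡ false
open Graph public

_==_ : ∀ {n} → Fin n → Fin n → Bool
i == j = does (i ≟ j)

data Walk {n : ℕ} (G : Graph n) : Fin n → Fin n → Set where
  here  : ∀ {u} → Walk G u u
  step  : ∀ {u w v} → adj G u w ≡ true → Walk G w v → Walk G u v

Connected : ∀ {n} → Graph n → Set
Connected G = ∀ u v → Walk G u v

Path : ∀ {n} → Graph n → List (Fin n) → Set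
Path G []           = ⊤
Path G (x ∷ [])     = ⊤
Path G (x ∷ y ∷ xs) = (adj G x y ≡ true) × Path G (y ∷ xs)

IsCycle : ∀ {n} → Graph n → List (Fin n) → Set
IsCycle G []       = ⊥
IsCycle G (v ∷ vs) =
  (3 ≤ length (v ∷ vs)) × Unique (v ∷ vs) × Path G (v ∷ vs)
    × (adj G (last (v ∷ vs) ⟨or⟩ v) v ≡ true)
  where
  _⟨or⟩_ : Maybe (Fin _) → Fin _ → Fin _
  just x ⟨or⟩ _ = x
  nothing ⟨or⟩ d = d

Acyclic : ∀ {n} → Graph n → Set
Acyclic G = ∀ c → ¬ IsCycle G c

IsTree : ∀ {n} → Graph n → Set
IsTree G = Connected G × Acyclic G

degree : ∀ {n} → Graph n → Fin n → ℕ
degree G v = length (filterᵇ (adj G v) (allFin _))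

IsLeaf : ∀ {n} → Graph n → Fin n → Set
IsLeaf G v = degree G v ≡ 1

delete : ∀ {n} → Graph (suc n) → Fin (suc n) → Graph n
delete G x = record
  { adj    = λ i j → adj G (punchIn x i) (punchIn x j)
  ; sym    = λ i j → sym G (punchIn x i) (punchIn x j)
  ; irrefl = λ i → irrefl G (punchIn x i)
  }

Edge : ℕ → Set
Edge n = Fin n × Fin n

-- Each edge {i,j} listed exactly once, as (i , j) with i < j.
edges : ∀ {n} → Graph n → List (Edge n)
edges {n} G =
  concatMap (λ i → map (λ j → (i , j))
    (filterᵇ (λ j → (suc (toℕ i) ≤ᵇ toℕ j) ∧ adj G i j) (allFin n)))
  (allFin n)

-- All sublists (= all subsets of a duplicate-free list).
subsets : ∀ {A : Set} → List A → List (List A)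
subsets []       = [] ∷ []
subsets (x ∷ xs) = let s = subsets xs in s ++ map (x ∷_) s

edgeEq : ∀ {n} → Edge n → Edge n → Bool
edgeEq (a , b) (c , d) = (a == c) ∧ (b == d)

memb : ∀ {n} → Edge n → List (Edge n) → Bool
memb e = any (edgeEq e)

⊆ᵇ : ∀ {n} → List (Edge n) → List (Edge n) → Bool
⊆ᵇ M S = all (λ e → memb e S) M

incident : ∀ {n} → Fin n → Edge n → Bool
incident v (a , b) = (v == a) ∨ (v == b)

share : ∀ {n} → Edge n → Edge n → Bool
share (a , b) f = incident a f ∨ incident b f

isMatching : ∀ {n} → List (Edge n) → Bool
isMatching M = all (λ e → all (λ f → edgeEq e f ∨ not (share e f)) M) M

isMaximalMatching : ∀ {n} → Graph n → List (Edge n) → Bool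
isMaximalMatching G M =
  isMatching M ∧
  all (λ S → not (isMatching S ∧ ⊆ᵇ M S) ∨ ⊆ᵇ S M) (subsets (edges G))

Ψ : ∀ {n} → Graph n → ℕ
Ψ G = length (filterᵇ (isMaximalMatching G) (subsets (edges G)))

-- Let x be a leaf of T with neighbour v. Adding xv whenever v is uncovered maps the maximal
-- matchings of T - x injectively to maximal matchings of T, and a maximal matching of T that
-- contains xv but misses some neighbour of v is not in the image. So Ψ(T) = Ψ(T - x) rules out
-- such matchings. If a neighbour y ≠ x of v had no leaf neighbour, one would arise greedily from
-- xv and an edge leading away from y at every other neighbour of y. Hence the neighbours of a
-- support vertex are leaves or support vertices, and a support vertex carries only one leaf; by
-- connectedness every vertex is then a leaf or a support vertex, and matching each leaf with its
-- support vertex is a fixed-point-free involution of the vertices.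

module Submission where

open import Defs hiding (sym)
open import Data.Bool using (Bool; true; false; T; not; _∧_; _∨_)
import Data.Bool as Bool
open import Data.Bool.Properties using (T-∧; T-∨; T-≡)
open import Data.Empty using (⊥; ⊥-elim)
open import Data.Fin as Fin using (Fin; toℕ; punchIn; punchOut; _≟_)
import Data.Fin.Properties as Finₚ
open import Data.List using (List; []; _∷_; _++_; [_]; map; filter; filterᵇ; length; allFin; last)
open import Data.Maybe using (just)
import Data.List.Properties as Listₚ
open import Data.List.Membership.Propositional using (_∈_; find; lose)
open import Data.List.Membership.Propositional.Properties
  using (∈-map⁺; ∈-map⁻; ∈-++⁺ˡ; ∈-++⁺ʳ; ∈-++⁻; ∈-∃++; ∈-filter⁺; ∈-filter⁻; ∈-allFin
        ; ∈-concat⁺′; ∈-concat⁻′)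
open import Data.List.Relation.Binary.Disjoint.Propositional using (Disjoint)
open import Data.List.Relation.Binary.Subset.Propositional using (_⊆_)
open import Data.List.Relation.Unary.Any as Any using (Any; here; there)
open import Data.List.Relation.Unary.Any.Properties using (any⁺; any⁻)
import Data.List.Relation.Unary.All as All
open import Data.List.Relation.Unary.All.Properties using (all⁺; all⁻)
import Data.List.Relation.Unary.All.Properties as Allₚ
import Data.List.Relation.Unary.AllPairs as AllPairs
import Data.List.Relation.Unary.AllPairs.Properties as AllPairsₚ
open import Data.List.Relation.Unary.Unique.Propositional using (Unique; []; _∷_)
import Data.List.Relation.Unary.Unique.Propositional.Properties as Uniqueₚ
open import Data.Nat as ℕ using (ℕ; zero; suc; _+_; _≤_; _<_; s≤s; z≤n)
import Data.Nat.Properties as ℕₚ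
open import Data.Nat.Divisibility using (_∣_; divides)
open import Data.Product using (_×_; _,_; ∃; proj₁; proj₂)
import Data.Product as Product
open import Data.Sum using (_⊎_; inj₁; inj₂; [_,_]′)
import Data.Sum as Sum
import Data.Product.Properties as Productₚ
open import Function using (id; _∘_; const; case_of_; _⇔_; mk⇔; Equivalence)
open import Relation.Nullary using (¬_; yes; no; Dec; does)
open import Relation.Nullary.Decidable using (T?)
import Relation.Nullary.Decidable as Dec
open import Relation.Unary using (Decidable)
open import Relation.Unary.Properties using (∁?)
open import Relation.Binary.Definitions using (tri<; tri≈; tri>)
open import Relation.Binary.PropositionalEquality hiding ([_])

open Equivalence using (to; from)

module _ {A : Set} where

  Unique⇒length≤ : {xs ys : List A} → Unique xs → xs ⊆ ys → length xs ≤ length ys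
  Unique⇒length≤ [] _ = z≤n
  Unique⇒length≤ {x ∷ xs} (x∉xs ∷ xs-unique) xs⊆ys with ∈-∃++ (xs⊆ys (here refl))
  ... | pre , post , refl =
    ℕₚ.≤-trans (s≤s (Unique⇒length≤ xs-unique xs⊆pre++post)) (ℕₚ.≤-reflexive length-removed)
    where
    xs⊆pre++post : xs ⊆ pre ++ post
    xs⊆pre++post {y} y∈xs with ∈-++⁻ pre (xs⊆ys (there y∈xs))
    ... | inj₁ y∈pre = ∈-++⁺ˡ y∈pre
    ... | inj₂ (here refl) = ⊥-elim (All.lookup x∉xs y∈xs refl)
    ... | inj₂ (there y∈post) = ∈-++⁺ʳ pre y∈post
    length-removed : suc (length (pre ++ post)) ≡ length (pre ++ x ∷ post)
    length-removed = begin
      suc (length (pre ++ post))     ≡⟨ cong suc (Listₚ.length-++ pre) ⟩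
      suc (length pre + length post) ≡⟨ ℕₚ.+-suc (length pre) (length post) ⟨
      length pre + length (x ∷ post) ≡⟨ Listₚ.length-++ pre ⟨
      length (pre ++ x ∷ post)       ∎
      where open ≡-Reasoning

  map-Unique : {B : Set} (f : A → B) {xs : List A} → Unique xs →
               (∀ {a b} → a ∈ xs → b ∈ xs → f a ≡ f b → a ≡ b) → Unique (map f xs)
  map-Unique f [] _ = []
  map-Unique f {x ∷ xs} (x∉xs ∷ xs-unique) f-inj =
    All.tabulate fx∉ ∷ map-Unique f xs-unique (λ a∈ b∈ → f-inj (there a∈) (there b∈))
    where
    fx∉ : ∀ {z} → z ∈ map f xs → f x ≢ z
    fx∉ z∈ with ∈-map⁻ f z∈
    ... | y , y∈xs , refl = All.lookup x∉xs y∈xs ∘ f-inj (here refl) (there y∈xs)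

  length≡1⇒∃∈ : ∀ {xs : List A} → length xs ≡ 1 → ∃ λ a → a ∈ xs
  length≡1⇒∃∈ {a ∷ []} _ = a , here refl

  length≡1⇒≡ : ∀ {xs : List A} {a b} → length xs ≡ 1 → a ∈ xs → b ∈ xs → a ≡ b
  length≡1⇒≡ {_ ∷ []} _ (here refl) (here refl) = refl

  last-∷ʳ : ∀ (a : A) xs y → last (a ∷ xs ++ [ y ]) ≡ just y
  last-∷ʳ a []       y = refl
  last-∷ʳ a (b ∷ xs) y = last-∷ʳ b xs y

  Unique-++⁻ˡ : ∀ (xs {ys} : List A) → Unique (xs ++ ys) → Unique xs
  Unique-++⁻ˡ []       _             = []
  Unique-++⁻ˡ (x ∷ xs) (x∉ ∷ unique) = Allₚ.++⁻ˡ xs x∉ ∷ Unique-++⁻ˡ xs unique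

  length-filter-∁ : ∀ {P : A → Set} (P? : Decidable P) xs →
                    length xs ≡ length (filter P? xs) + length (filter (∁? P?) xs)
  length-filter-∁ P? [] = refl
  length-filter-∁ P? (x ∷ xs) with P? x
  ... | yes _ = cong suc (length-filter-∁ P? xs)
  ... | no  _ = trans (cong suc (length-filter-∁ P? xs)) (sym (ℕₚ.+-suc _ _))

length≢1⇒∃∈≢ : ∀ {m} {xs : List (Fin m)} {a} → Unique xs → a ∈ xs → length xs ≢ 1 →
               ∀ w → ∃ λ z → z ∈ xs × z ≢ w
length≢1⇒∃∈≢ {xs = _ ∷ []} _ _ length≢1 _ = ⊥-elim (length≢1 refl)
length≢1⇒∃∈≢ {xs = b ∷ c ∷ _} ((b≢c All.∷ _) ∷ _) _ _ w with b ≟ w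
... | no b≢w   = b , here refl , b≢w
... | yes refl = c , there (here refl) , b≢c ∘ sym

module _ {A : Set} where

  ∈-subsets-∷⁻ : ∀ {x : A} {xs S} → S ∈ subsets (x ∷ xs) →
                 S ∈ subsets xs ⊎ ∃ λ S₀ → S₀ ∈ subsets xs × S ≡ x ∷ S₀
  ∈-subsets-∷⁻ {xs = xs} S∈ with ∈-++⁻ (subsets xs) S∈
  ... | inj₁ S∈xs = inj₁ S∈xs
  ... | inj₂ S∈x∷ = inj₂ (∈-map⁻ (_ ∷_) S∈x∷)

  ∈-subsets⇒⊆ : ∀ {xs S : List A} → S ∈ subsets xs → S ⊆ xs
  ∈-subsets⇒⊆ {[]} (here refl) ()
  ∈-subsets⇒⊆ {x ∷ xs} S∈ y∈S with ∈-subsets-∷⁻ {x} {xs} S∈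
  ... | inj₁ S∈xs = there (∈-subsets⇒⊆ S∈xs y∈S)
  ... | inj₂ (S₀ , S₀∈ , refl) with y∈S
  ...   | here refl = here refl
  ...   | there y∈S₀ = there (∈-subsets⇒⊆ S₀∈ y∈S₀)

  filter-∈-subsets : ∀ {P : A → Set} (P? : Decidable P) xs → filter P? xs ∈ subsets xs
  filter-∈-subsets P? [] = here refl
  filter-∈-subsets P? (x ∷ xs) with does (P? x)
  ... | true  = ∈-++⁺ʳ (subsets xs) (∈-map⁺ (x ∷_) (filter-∈-subsets P? xs))
  ... | false = ∈-++⁺ˡ (filter-∈-subsets P? xs)

  ∉-subsets : ∀ {x : A} {xs S} → All.All (x ≢_) xs → S ∈ subsets xs → ¬ x ∈ S
  ∉-subsets x∉xs S∈ x∈S = Allₚ.All¬⇒¬Any x∉xs (∈-subsets⇒⊆ S∈ x∈S)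

  subsets-Unique : {xs : List A} → Unique xs → Unique (subsets xs)
  subsets-Unique [] = All.[] ∷ []
  subsets-Unique {x ∷ xs} (x∉xs ∷ xs-unique) =
    Uniqueₚ.++⁺ (subsets-Unique xs-unique) (Uniqueₚ.map⁺ ∷-injectiveʳ (subsets-Unique xs-unique)) disjoint
    where
    ∷-injectiveʳ : ∀ {S S′} → x ∷ S ≡ x ∷ S′ → S ≡ S′
    ∷-injectiveʳ refl = refl
    disjoint : ∀ {S} → ¬ (S ∈ subsets xs × S ∈ map (x ∷_) (subsets xs))
    disjoint (S∈ , S∈x∷) with ∈-map⁻ (x ∷_) S∈x∷
    ... | _ , _ , refl = ∉-subsets x∉xs S∈ (here refl)

  subsets-ext : ∀ {xs S S′ : List A} → Unique xs → S ∈ subsets xs → S′ ∈ subsets xs →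
                S ⊆ S′ → S′ ⊆ S → S ≡ S′
  subsets-ext {[]} _ (here refl) (here refl) _ _ = refl
  subsets-ext {x ∷ xs} (x∉xs ∷ u) S∈ S′∈ S⊆S′ S′⊆S
    with ∈-subsets-∷⁻ {x} {xs} S∈ | ∈-subsets-∷⁻ {x} {xs} S′∈
  ... | inj₁ S∈xs | inj₁ S′∈xs = subsets-ext u S∈xs S′∈xs S⊆S′ S′⊆S
  ... | inj₁ S∈xs | inj₂ (_ , _ , refl) = ⊥-elim (∉-subsets x∉xs S∈xs (S′⊆S (here refl)))
  ... | inj₂ (_ , _ , refl) | inj₁ S′∈xs = ⊥-elim (∉-subsets x∉xs S′∈xs (S⊆S′ (here refl)))
  ... | inj₂ (S₀ , S₀∈ , refl) | inj₂ (S₀′ , S₀′∈ , refl) =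
    cong (x ∷_) (subsets-ext u S₀∈ S₀′∈ (drop-x S₀∈ S⊆S′) (drop-x S₀′∈ S′⊆S))
    where
    drop-x : ∀ {R R′} → R ∈ subsets xs → (x ∷ R) ⊆ (x ∷ R′) → R ⊆ R′
    drop-x R∈ x∷R⊆x∷R′ y∈R with x∷R⊆x∷R′ (there y∈R)
    ... | here refl  = ⊥-elim (∉-subsets x∉xs R∈ y∈R)
    ... | there y∈R′ = y∈R′

Inc : ∀ {n} → Fin n → Edge n → Set
Inc u (a , b) = u ≡ a ⊎ u ≡ b

Share : ∀ {n} → Edge n → Edge n → Set
Share e f = ∃ λ u → Inc u e × Inc u f

Share-sym : ∀ {n} {e f : Edge n} → Share e f → Share f e
Share-sym (u , u∈e , u∈f) = u , u∈f , u∈e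

Share-refl : ∀ {n} (e : Edge n) → Share e e
Share-refl (a , _) = a , inj₁ refl , inj₁ refl

inc? : ∀ {n} (u : Fin n) e → Dec (Inc u e)
inc? u (a , b) = (u ≟ a) Dec.⊎-dec (u ≟ b)

IsEdge : ∀ {n} → Graph n → Edge n → Set
IsEdge G (i , j) = i Fin.< j × adj G i j ≡ true

edgeBetween : ∀ {n} → Fin n → Fin n → Edge n
edgeBetween a b with Finₚ.<-cmp a b
... | tri> _ _ _ = b , a
... | _          = a , b

Inc-edgeBetween : ∀ {n} {u : Fin n} a b → Inc u (edgeBetween a b) ⇔ (u ≡ a ⊎ u ≡ b)
Inc-edgeBetween a b with Finₚ.<-cmp a b
... | tri< _ _ _ = mk⇔ id id
... | tri≈ _ _ _ = mk⇔ id id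
... | tri> _ _ _ = mk⇔ Sum.swap Sum.swap

edgeBetween-< : ∀ {n} {a b : Fin n} → a Fin.< b → edgeBetween a b ≡ (a , b)
edgeBetween-< {a = a} {b} a<b with Finₚ.<-cmp a b
... | tri< _ _ _ = refl
... | tri≈ a≮b _ _ = ⊥-elim (a≮b a<b)
... | tri> a≮b _ _ = ⊥-elim (a≮b a<b)

edgeBetween-> : ∀ {n} {a b : Fin n} → b Fin.< a → edgeBetween a b ≡ (b , a)
edgeBetween-> {a = a} {b} b<a with Finₚ.<-cmp a b
... | tri< _ _ b≮a = ⊥-elim (b≮a b<a)
... | tri≈ _ _ b≮a = ⊥-elim (b≮a b<a)
... | tri> _ _ _ = refl

module _ {n} (G : Graph n) where

  adj-sym : ∀ {a b} → adj G a b ≡ true → adj G b a ≡ true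
  adj-sym {a} {b} ab = trans (Graph.sym G b a) ab

  adj⇒≢ : ∀ {a b} → adj G a b ≡ true → a ≢ b
  adj⇒≢ {a} aa refl = case trans (sym aa) (irrefl G a) of λ ()

  private
    isEdgeᵇ : Fin n → Fin n → Bool
    isEdgeᵇ i j = (suc (toℕ i) ℕ.≤ᵇ toℕ j) ∧ adj G i j

    row : Fin n → List (Edge n)
    row i = map (i ,_) (filterᵇ (isEdgeᵇ i) (allFin n))

    ∈-row⁻ : ∀ {i e} → e ∈ row i → proj₁ e ≡ i
    ∈-row⁻ {i} e∈ with ∈-map⁻ (i ,_) e∈
    ... | _ , _ , refl = refl

  ∈-edges⁻ : ∀ {e} → e ∈ edges G → IsEdge G e
  ∈-edges⁻ e∈ with ∈-concat⁻′ (map row (allFin n)) e∈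
  ... | es , e∈es , es∈rows with ∈-map⁻ row es∈rows
  ...   | i , _ , refl with ∈-map⁻ (i ,_) e∈es
  ...     | j , j∈ , refl with to T-∧ (proj₂ (∈-filter⁻ (T? ∘ isEdgeᵇ i) {xs = allFin n} j∈))
  ...       | i<j , ij = ℕₚ.≤ᵇ⇒≤ _ _ i<j , to T-≡ ij

  ∈-edges⁺ : ∀ {e} → IsEdge G e → e ∈ edges G
  ∈-edges⁺ {i , j} (i<j , ij) =
    ∈-concat⁺′ (∈-map⁺ (i ,_) (∈-filter⁺ (T? ∘ isEdgeᵇ i) (∈-allFin j) j-later))
               (∈-map⁺ row (∈-allFin i))
    where
    j-later : T (isEdgeᵇ i j)
    j-later = from T-∧ (ℕₚ.≤⇒≤ᵇ i<j , from T-≡ ij)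

  edges-Unique : Unique (edges G)
  edges-Unique = Uniqueₚ.concat⁺ (Allₚ.map⁺ (All.universal row-Unique (allFin n)))
                                 (AllPairsₚ.map⁺ (AllPairs.map rows-disjoint (Uniqueₚ.allFin⁺ n)))
    where
    row-Unique : ∀ i → Unique (row i)
    row-Unique i =
      Uniqueₚ.map⁺ Productₚ.,-injectiveʳ (Uniqueₚ.filter⁺ (T? ∘ isEdgeᵇ i) (Uniqueₚ.allFin⁺ n))
    rows-disjoint : ∀ {i j} → i ≢ j → Disjoint (row i) (row j)
    rows-disjoint i≢j (e∈i , e∈j) = i≢j (trans (sym (∈-row⁻ e∈i)) (∈-row⁻ e∈j))

  other-end : ∀ {e w} → e ∈ edges G → Inc w e → ∃ λ z → adj G w z ≡ true × Inc z e
  other-end {a , b} e∈ (inj₁ refl) = b , proj₂ (∈-edges⁻ e∈) , inj₂ refl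
  other-end {a , b} e∈ (inj₂ refl) = a , adj-sym (proj₂ (∈-edges⁻ e∈)) , inj₁ refl

  edgeBetween-∈-edges : ∀ {a b} → adj G a b ≡ true → edgeBetween a b ∈ edges G
  edgeBetween-∈-edges {a} {b} ab with Finₚ.<-cmp a b
  ... | tri< a<b _ _ = ∈-edges⁺ (a<b , ab)
  ... | tri≈ _ refl _ = ⊥-elim (adj⇒≢ ab refl)
  ... | tri> _ _ b<a = ∈-edges⁺ (b<a , adj-sym ab)

  edge-with-ends : ∀ {e a b} → e ∈ edges G → Inc a e → Inc b e → a ≢ b → e ≡ edgeBetween a b
  edge-with-ends e∈ (inj₁ refl) (inj₁ refl) a≢b = ⊥-elim (a≢b refl)
  edge-with-ends e∈ (inj₁ refl) (inj₂ refl) _ = sym (edgeBetween-< (proj₁ (∈-edges⁻ e∈)))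
  edge-with-ends e∈ (inj₂ refl) (inj₁ refl) _ = sym (edgeBetween-> (proj₁ (∈-edges⁻ e∈)))
  edge-with-ends e∈ (inj₂ refl) (inj₂ refl) a≢b = ⊥-elim (a≢b refl)

T-not : ∀ {b} → T (not b) ⇔ (¬ T b)
T-not {true}  = mk⇔ (λ ()) (λ ¬t → ¬t _)
T-not {false} = mk⇔ (λ _ ()) (const _)

T-== : ∀ {n} {i j : Fin n} → T (i == j) ⇔ i ≡ j
T-== {i = i} {j} with i ≟ j
... | yes i≡j = mk⇔ (const i≡j) (const _)
... | no  i≢j = mk⇔ (λ ()) i≢j

_≟ₑ_ : ∀ {n} (e f : Edge n) → Dec (e ≡ f)
_≟ₑ_ = Productₚ.≡-dec _≟_ _≟_

T-edgeEq : ∀ {n} {e f : Edge n} → T (edgeEq e f) ⇔ e ≡ f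
T-edgeEq {e = a , b} {c , d} =
  mk⇔ (λ t → let a≡c , b≡d = to T-∧ t in cong₂ _,_ (to T-== a≡c) (to T-== b≡d))
      (λ { refl → from T-∧ (from (T-== {i = a}) refl , from (T-== {i = b}) refl) })

T-incident : ∀ {n} {u : Fin n} {e} → T (incident u e) ⇔ Inc u e
T-incident {e = a , b} =
  mk⇔ (λ t → Sum.map (to T-==) (to T-==) (to T-∨ t))
      (λ i → from T-∨ (Sum.map (from T-==) (from T-==) i))

T-share : ∀ {n} {e f : Edge n} → T (share e f) ⇔ Share e f
T-share {e = a , b} {f} = mk⇔ sound complete
  where
  sound : T (share (a , b) f) → Share (a , b) f
  sound t with to T-∨ t
  ... | inj₁ a∈f = a , inj₁ refl , to T-incident a∈f
  ... | inj₂ b∈f = b , inj₂ refl , to T-incident b∈f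
  complete : Share (a , b) f → T (share (a , b) f)
  complete (u , inj₁ refl , u∈f) = from T-∨ (inj₁ (from T-incident u∈f))
  complete (u , inj₂ refl , u∈f) = from (T-∨ {incident a f}) (inj₂ (from T-incident u∈f))

share? : ∀ {n} (e f : Edge n) → Dec (Share e f)
share? e f = Dec.map T-share (T? (share e f))

Covered : ∀ {n} → Fin n → List (Edge n) → Set
Covered u M = ∃ λ e → e ∈ M × Inc u e

covered? : ∀ {n} (u : Fin n) M → Dec (Covered u M)
covered? u M = Dec.map (mk⇔ find λ (e , e∈ , u∈e) → lose e∈ u∈e) (Any.any? (inc? u) M)

Matching : ∀ {n} → List (Edge n) → Set
Matching M = ∀ {e f} → e ∈ M → f ∈ M → Share e f → e ≡ f

Dominates : ∀ {n} → Graph n → List (Edge n) → Set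
Dominates G M = ∀ {e} → e ∈ edges G → e ∈ M ⊎ ∃ λ f → f ∈ M × Share e f

Matching-⊆ : ∀ {n} {M M′ : List (Edge n)} → M ⊆ M′ → Matching M′ → Matching M
Matching-⊆ M⊆M′ M′-matching e∈ f∈ = M′-matching (M⊆M′ e∈) (M⊆M′ f∈)

Matching-∷ : ∀ {n} {e} {M : List (Edge n)} → Matching M → (∀ {f} → f ∈ M → ¬ Share e f) →
             Matching (e ∷ M)
Matching-∷ M-matching e-free (here refl) (here refl) _ = refl
Matching-∷ M-matching e-free (here refl) (there f∈) s = ⊥-elim (e-free f∈ s)
Matching-∷ M-matching e-free (there e∈) (here refl) s = ⊥-elim (e-free e∈ (Share-sym s))
Matching-∷ M-matching e-free (there e∈) (there f∈) s = M-matching e∈ f∈ s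

T-memb : ∀ {n} {e : Edge n} {S} → T (memb e S) ⇔ e ∈ S
T-memb {S = S} = mk⇔ (Any.map (to T-edgeEq) ∘ any⁻ _ S) (any⁺ _ ∘ Any.map (from T-edgeEq))

T-⊆ᵇ : ∀ {n} {M S : List (Edge n)} → T (⊆ᵇ M S) ⇔ M ⊆ S
T-⊆ᵇ {M = M} {S} = mk⇔ sound complete
  where
  sound : T (⊆ᵇ M S) → M ⊆ S
  sound t e∈M = to T-memb (All.lookup (all⁺ _ M t) e∈M)
  complete : M ⊆ S → T (⊆ᵇ M S)
  complete M⊆S = all⁻ _ (All.tabulate (λ e∈M → from T-memb (M⊆S e∈M)))

T-isMatching : ∀ {n} {M : List (Edge n)} → T (isMatching M) ⇔ Matching M
T-isMatching {M = M} = mk⇔ sound complete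
  where
  sound : T (isMatching M) → Matching M
  sound t {e} {f} e∈ f∈ s with to T-∨ (All.lookup (all⁺ _ M (All.lookup (all⁺ _ M t) e∈)) f∈)
  ... | inj₁ e≡f = to T-edgeEq e≡f
  ... | inj₂ ¬s  = ⊥-elim (to T-not ¬s (from T-share s))
  complete : Matching M → T (isMatching M)
  complete mat = all⁻ _ (All.tabulate λ e∈ → all⁻ _ (All.tabulate λ f∈ → ok e∈ f∈))
    where
    ok : ∀ {e f} → e ∈ M → f ∈ M → T (edgeEq e f ∨ not (share e f))
    ok {e} {f} e∈ f∈ with share? e f
    ... | yes s = from T-∨ (inj₁ (from T-edgeEq (mat e∈ f∈ s)))
    ... | no ¬s = from T-∨ (inj₂ (from T-not (¬s ∘ to T-share)))

_∈ₑ?_ : ∀ {n} (e : Edge n) (R : List (Edge n)) → Dec (e ∈ R)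
e ∈ₑ? R = Any.any? (e ≟ₑ_) R

-- The representative of R among the subsets of edges G.
restrict : ∀ {n} → Graph n → List (Edge n) → List (Edge n)
restrict G R = filter (_∈ₑ? R) (edges G)

maximalMatchings : ∀ {n} → Graph n → List (List (Edge n))
maximalMatchings G = filterᵇ (isMaximalMatching G) (subsets (edges G))

module _ {n} (G : Graph n) where

  ∈-restrict⁺ : ∀ {e R} → e ∈ edges G → e ∈ R → e ∈ restrict G R
  ∈-restrict⁺ {R = R} = ∈-filter⁺ (_∈ₑ? R)

  ∈-restrict⁻ : ∀ {e R} → e ∈ restrict G R → e ∈ edges G × e ∈ R
  ∈-restrict⁻ {R = R} = ∈-filter⁻ (_∈ₑ? R)

  isMaximalMatching⁺ : ∀ {M} → Matching M → Dominates G M → T (isMaximalMatching G M)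
  isMaximalMatching⁺ {M} M-matching M-dominates =
    from T-∧ (from T-isMatching M-matching , all⁻ _ (All.tabulate no-larger))
    where
    no-larger : ∀ {S} → S ∈ subsets (edges G) → T (not (isMatching S ∧ ⊆ᵇ M S) ∨ ⊆ᵇ S M)
    no-larger {S} S∈ with T? (isMatching S ∧ ⊆ᵇ M S)
    ... | no  ¬larger = from T-∨ (inj₁ (from T-not ¬larger))
    ... | yes larger  = from (T-∨ {not (isMatching S ∧ ⊆ᵇ M S)}) (inj₂ (from T-⊆ᵇ S⊆M))
      where
      S-matching : Matching S
      S-matching = to T-isMatching (proj₁ (to T-∧ larger))
      M⊆S : M ⊆ S
      M⊆S = to T-⊆ᵇ (proj₂ (to (T-∧ {isMatching S}) larger))
      S⊆M : S ⊆ M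
      S⊆M e∈S with M-dominates (∈-subsets⇒⊆ S∈ e∈S)
      ... | inj₁ e∈M = e∈M
      ... | inj₂ (f , f∈M , s) = subst (_∈ M) (sym (S-matching e∈S (M⊆S f∈M) s)) f∈M

  isMaximalMatching⁻ : ∀ {M} → M ∈ subsets (edges G) → T (isMaximalMatching G M) →
                       Matching M × Dominates G M
  isMaximalMatching⁻ {M} M∈ t = M-matching , M-dominates
    where
    M-matching : Matching M
    M-matching = to T-isMatching (proj₁ (to T-∧ t))
    M-dominates : Dominates G M
    M-dominates {e} e∈G with e ∈ₑ? M | Any.any? (share? e) M
    ... | yes e∈M | _ = inj₁ e∈M
    ... | no _ | yes meets = inj₂ (find meets)
    ... | no e∉M | no ¬meets = ⊥-elim (e∉M (to T-⊆ᵇ S⊆M (∈-restrict⁺ e∈G (here refl))))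
      where
      S = restrict G (e ∷ M)
      S-matching : Matching S
      S-matching = Matching-⊆ (proj₂ ∘ ∈-restrict⁻)
                     (Matching-∷ M-matching (λ f∈M s → ¬meets (lose f∈M s)))
      M⊆S : M ⊆ S
      M⊆S f∈M = ∈-restrict⁺ (∈-subsets⇒⊆ M∈ f∈M) (there f∈M)
      S⊆M : T (⊆ᵇ S M)
      S⊆M with to T-∨ (All.lookup (all⁺ _ _ (proj₂ (to (T-∧ {isMatching M}) t)))
                                  (filter-∈-subsets (_∈ₑ? (e ∷ M)) (edges G)))
      ... | inj₁ ¬larger =
        ⊥-elim (to T-not ¬larger (from T-∧ (from T-isMatching S-matching , from T-⊆ᵇ M⊆S)))
      ... | inj₂ S⊆ᵇM = S⊆ᵇM

  ∈-maximalMatchings⁻ : ∀ {M} → M ∈ maximalMatchings G →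
                        M ∈ subsets (edges G) × Matching M × Dominates G M
  ∈-maximalMatchings⁻ M∈ = let M∈S , t = ∈-filter⁻ (T? ∘ isMaximalMatching G) M∈
                           in M∈S , isMaximalMatching⁻ M∈S t

  restrict-∈-maximalMatchings : ∀ {R} → R ⊆ edges G → Matching R → Dominates G R →
                                restrict G R ∈ maximalMatchings G
  restrict-∈-maximalMatchings {R} R⊆G R-matching R-dominates =
    ∈-filter⁺ (T? ∘ isMaximalMatching G) (filter-∈-subsets (_∈ₑ? R) (edges G))
      (isMaximalMatching⁺ (Matching-⊆ (proj₂ ∘ ∈-restrict⁻) R-matching) dominates)
    where
    keep : ∀ {e} → e ∈ R → e ∈ restrict G R
    keep e∈R = ∈-restrict⁺ (R⊆G e∈R) e∈R
    dominates : Dominates G (restrict G R)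
    dominates e∈G with R-dominates e∈G
    ... | inj₁ e∈R = inj₁ (keep e∈R)
    ... | inj₂ (f , f∈R , s) = inj₂ (f , keep f∈R , s)

  maximalMatchings-Unique : Unique (maximalMatchings G)
  maximalMatchings-Unique = Uniqueₚ.filter⁺ (T? ∘ isMaximalMatching G) (subsets-Unique (edges-Unique G))

-- Greedy extension of a matching to a maximal one

greedy : ∀ {n} → List (Edge n) → List (Edge n) → List (Edge n)
greedy []       M = M
greedy (e ∷ es) M with Any.any? (share? e) M
... | yes _ = greedy es M
... | no  _ = greedy es (e ∷ M)

greedy-⊇ : ∀ {n} es {M : List (Edge n)} → M ⊆ greedy es M
greedy-⊇ [] e∈ = e∈
greedy-⊇ (f ∷ es) {M} e∈ with Any.any? (share? f) M
... | yes _ = greedy-⊇ es e∈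
... | no  _ = greedy-⊇ es (there e∈)

∈-greedy⁻ : ∀ {n} es {M : List (Edge n)} {g} → g ∈ greedy es M →
            g ∈ M ⊎ (g ∈ es × ∀ {f} → f ∈ M → ¬ Share g f)
∈-greedy⁻ [] g∈ = inj₁ g∈
∈-greedy⁻ (e ∷ es) {M} g∈ with Any.any? (share? e) M
... | yes _ = Sum.map₂ (Product.map₁ there) (∈-greedy⁻ es g∈)
... | no e-free with ∈-greedy⁻ es g∈
...   | inj₁ (here refl)        = inj₂ (here refl , λ f∈ s → e-free (lose f∈ s))
...   | inj₁ (there g∈M)        = inj₁ g∈M
...   | inj₂ (g∈es , g-free)    = inj₂ (there g∈es , g-free ∘ there)

greedy-Matching : ∀ {n} es {M : List (Edge n)} → Matching M → Matching (greedy es M)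
greedy-Matching [] M-matching = M-matching
greedy-Matching (e ∷ es) {M} M-matching with Any.any? (share? e) M
... | yes _     = greedy-Matching es M-matching
... | no e-free = greedy-Matching es (Matching-∷ M-matching (λ f∈ s → e-free (lose f∈ s)))

greedy-meets : ∀ {n} es {M : List (Edge n)} {e} → e ∈ es → ∃ λ f → f ∈ greedy es M × Share e f
greedy-meets (e ∷ es) {M} (here refl) with Any.any? (share? e) M
... | yes meets = let f , f∈M , s = find meets in f , greedy-⊇ es f∈M , s
... | no _      = e , greedy-⊇ es (here refl) , Share-refl e
greedy-meets (e′ ∷ es) {M} (there e∈) with Any.any? (share? e′) M
... | yes _ = greedy-meets es e∈
... | no _  = greedy-meets es e∈

module _ {n} (G : Graph n) where

  extendMaximal : List (Edge n) → List (Edge n)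
  extendMaximal M₀ = restrict G (greedy (edges G) M₀)

  extendMaximal-∈ : ∀ {M₀} → M₀ ⊆ edges G → Matching M₀ → extendMaximal M₀ ∈ maximalMatchings G
  extendMaximal-∈ {M₀} M₀⊆G M₀-matching =
    restrict-∈-maximalMatchings G greedy⊆G (greedy-Matching (edges G) M₀-matching)
                                (inj₂ ∘ greedy-meets (edges G))
    where
    greedy⊆G : greedy (edges G) M₀ ⊆ edges G
    greedy⊆G g∈ = [ M₀⊆G , proj₁ ]′ (∈-greedy⁻ (edges G) g∈)

  extendMaximal-⊇ : ∀ {M₀} → M₀ ⊆ edges G → M₀ ⊆ extendMaximal M₀
  extendMaximal-⊇ M₀⊆G e∈ = ∈-restrict⁺ G (M₀⊆G e∈) (greedy-⊇ (edges G) e∈)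

  ∈-extendMaximal⁻ : ∀ {M₀ g} → g ∈ extendMaximal M₀ → g ∈ M₀ ⊎ (∀ {f} → f ∈ M₀ → ¬ Share g f)
  ∈-extendMaximal⁻ g∈ = Sum.map₂ proj₂ (∈-greedy⁻ (edges G) (proj₂ (∈-restrict⁻ G g∈)))

-- Deleting a leaf x with neighbour v

module LeafDeletion {n} (G : Graph (suc n)) {x v : Fin (suc n)}
  (xv : adj G x v ≡ true) (x-only-v : ∀ {u} → adj G x u ≡ true → u ≡ v) where

  G⁻ : Graph n
  G⁻ = delete G x

  lift : Edge n → Edge (suc n)
  lift (i , j) = punchIn x i , punchIn x j

  lift-∈-edges : ∀ {e} → e ∈ edges G⁻ → lift e ∈ edges G
  lift-∈-edges {i , j} e∈ with ∈-edges⁻ G⁻ e∈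
  ... | i<j , ij = ∈-edges⁺ G (Finₚ.≤∧≢⇒< (Finₚ.punchIn-mono-≤ x i j (ℕₚ.<⇒≤ i<j))
                                           (Finₚ.<⇒≢ i<j ∘ Finₚ.punchIn-injective x i j) , ij)

  lift-injective : ∀ {e f} → lift e ≡ lift f → e ≡ f
  lift-injective {a , b} {c , d} eq =
    cong₂ _,_ (Finₚ.punchIn-injective x a c (cong proj₁ eq))
              (Finₚ.punchIn-injective x b d (cong proj₂ eq))

  Inc-lift : ∀ {u e} → Inc u e → Inc (punchIn x u) (lift e)
  Inc-lift {e = a , b} = Sum.map (cong (punchIn x)) (cong (punchIn x))

  x∉lift : ∀ e → ¬ Inc x (lift e)
  x∉lift (a , b) = [ Finₚ.punchInᵢ≢i x a ∘ sym , Finₚ.punchInᵢ≢i x b ∘ sym ]′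

  Inc-lift⁻ : ∀ {c e} → Inc c (lift e) → ∃ λ u → c ≡ punchIn x u × Inc u e
  Inc-lift⁻ {e = a , b} (inj₁ refl) = a , refl , inj₁ refl
  Inc-lift⁻ {e = a , b} (inj₂ refl) = b , refl , inj₂ refl

  Share-lift⁺ : ∀ {e f} → Share e f → Share (lift e) (lift f)
  Share-lift⁺ (u , u∈e , u∈f) = punchIn x u , Inc-lift u∈e , Inc-lift u∈f

  Share-lift⁻ : ∀ {e f} → Share (lift e) (lift f) → Share e f
  Share-lift⁻ (c , c∈e , c∈f) with Inc-lift⁻ c∈e | Inc-lift⁻ c∈f
  ... | u , refl , u∈e | u′ , eq , u′∈f with Finₚ.punchIn-injective x u u′ eq
  ...   | refl = u , u∈e , u′∈f

  unlift : ∀ {e} → e ∈ edges G → ¬ Inc x e → ∃ λ e′ → e′ ∈ edges G⁻ × lift e′ ≡ e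
  unlift {a , b} e∈ x∉e with ∈-edges⁻ G e∈
  ... | a<b , ab = (a′ , b′) , ∈-edges⁺ G⁻ (a′<b′ , ab′) , cong₂ _,_ a′↦a b′↦b
    where
    x≢a : x ≢ a
    x≢a = x∉e ∘ inj₁
    x≢b : x ≢ b
    x≢b = x∉e ∘ inj₂
    a′ = punchOut x≢a
    b′ = punchOut x≢b
    a′↦a : punchIn x a′ ≡ a
    a′↦a = Finₚ.punchIn-punchOut x≢a
    b′↦b : punchIn x b′ ≡ b
    b′↦b = Finₚ.punchIn-punchOut x≢b
    ab′ : adj G⁻ a′ b′ ≡ true
    ab′ = subst₂ (λ c d → adj G c d ≡ true) (sym a′↦a) (sym b′↦b) ab
    a′<b′ : a′ Fin.< b′
    a′<b′ = Finₚ.≤∧≢⇒<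
      (Finₚ.punchIn-cancel-≤ x a′ b′ (subst₂ Fin._≤_ (sym a′↦a) (sym b′↦b) (ℕₚ.<⇒≤ a<b)))
      (λ a′≡b′ → Finₚ.<⇒≢ a<b (trans (sym a′↦a) (trans (cong (punchIn x) a′≡b′) b′↦b)))

  xvEdge : Edge (suc n)
  xvEdge = edgeBetween x v

  xvEdge-∈-edges : xvEdge ∈ edges G
  xvEdge-∈-edges = edgeBetween-∈-edges G xv

  x∈xvEdge : Inc x xvEdge
  x∈xvEdge = from (Inc-edgeBetween x v) (inj₁ refl)

  v∈xvEdge : Inc v xvEdge
  v∈xvEdge = from (Inc-edgeBetween x v) (inj₂ refl)

  edge-at-x : ∀ {e} → e ∈ edges G → Inc x e → e ≡ xvEdge
  edge-at-x e∈ x∈e with other-end G e∈ x∈e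
  ... | z , xz , z∈e with x-only-v xz
  ...   | refl = edge-with-ends G e∈ x∈e z∈e (adj⇒≢ G xv)

  -- A maximal matching N of G - x becomes one of G by adding xv when v is uncovered.
  pendant : List (Edge n) → List (Edge (suc n))
  pendant N with covered? v (map lift N)
  ... | yes _ = []
  ... | no  _ = [ xvEdge ]

  raise : List (Edge n) → List (Edge (suc n))
  raise N = map lift N ++ pendant N

  ∈-raise⁻ : ∀ {N e} → e ∈ raise N →
             (∃ λ a → a ∈ N × e ≡ lift a) ⊎ (e ≡ xvEdge × ¬ Covered v (map lift N))
  ∈-raise⁻ {N} e∈ with ∈-++⁻ (map lift N) e∈
  ... | inj₁ e∈lifts = inj₁ (∈-map⁻ lift e∈lifts)
  ... | inj₂ e∈pendant with covered? v (map lift N) | e∈pendant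
  ...   | no v-free | here refl = inj₂ (refl , v-free)

  lift-∈-raise : ∀ {N a} → a ∈ N → lift a ∈ raise N
  lift-∈-raise a∈ = ∈-++⁺ˡ (∈-map⁺ lift a∈)

  xvEdge-dominated : ∀ N → xvEdge ∈ raise N ⊎ ∃ λ f → f ∈ raise N × Share xvEdge f
  xvEdge-dominated N with covered? v (map lift N)
  ... | yes (f , f∈ , v∈f) = inj₂ (f , ∈-++⁺ˡ f∈ , v , v∈xvEdge , v∈f)
  ... | no _               = inj₁ (∈-++⁺ʳ (map lift N) (here refl))

  xvEdge-free : ∀ {N a} → ¬ Covered v (map lift N) → a ∈ N → ¬ Share xvEdge (lift a)
  xvEdge-free v-free a∈ (c , c∈xv , c∈a) with to (Inc-edgeBetween x v) c∈xv
  ... | inj₁ refl = x∉lift _ c∈a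
  ... | inj₂ refl = v-free (lift _ , ∈-map⁺ lift a∈ , c∈a)

  module _ {N} (N∈ : N ∈ maximalMatchings G⁻) where

    private
      N-subset = proj₁ (∈-maximalMatchings⁻ G⁻ N∈)
      N-matching = proj₁ (proj₂ (∈-maximalMatchings⁻ G⁻ N∈))
      N-dominates = proj₂ (proj₂ (∈-maximalMatchings⁻ G⁻ N∈))

    raise-⊆-edges : raise N ⊆ edges G
    raise-⊆-edges e∈ with ∈-raise⁻ e∈
    ... | inj₁ (a , a∈ , refl) = lift-∈-edges (∈-subsets⇒⊆ N-subset a∈)
    ... | inj₂ (refl , _)      = xvEdge-∈-edges

    raise-Matching : Matching (raise N)
    raise-Matching e∈ f∈ s with ∈-raise⁻ e∈ | ∈-raise⁻ f∈
    ... | inj₁ (a , a∈ , refl) | inj₁ (b , b∈ , refl) = cong lift (N-matching a∈ b∈ (Share-lift⁻ s))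
    ... | inj₁ (a , a∈ , refl) | inj₂ (refl , v-free) = ⊥-elim (xvEdge-free v-free a∈ (Share-sym s))
    ... | inj₂ (refl , v-free) | inj₁ (b , b∈ , refl) = ⊥-elim (xvEdge-free v-free b∈ s)
    ... | inj₂ (refl , _)      | inj₂ (refl , _)      = refl

    raise-Dominates : Dominates G (raise N)
    raise-Dominates {e} e∈ with inc? x e
    ... | yes x∈e with edge-at-x e∈ x∈e
    ...   | refl = xvEdge-dominated N
    raise-Dominates {e} e∈ | no x∉e with unlift e∈ x∉e
    ... | e′ , e′∈ , refl with N-dominates e′∈
    ...   | inj₁ e′∈N            = inj₁ (lift-∈-raise e′∈N)
    ...   | inj₂ (f , f∈N , s)   = inj₂ (lift f , lift-∈-raise f∈N , Share-lift⁺ s)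

  extend : List (Edge n) → List (Edge (suc n))
  extend N = restrict G (raise N)

  extend-∈ : ∀ {N} → N ∈ maximalMatchings G⁻ → extend N ∈ maximalMatchings G
  extend-∈ N∈ =
    restrict-∈-maximalMatchings G (raise-⊆-edges N∈) (raise-Matching N∈) (raise-Dominates N∈)

  lift-∈-extend⁺ : ∀ {N a} → N ∈ maximalMatchings G⁻ → a ∈ N → lift a ∈ extend N
  lift-∈-extend⁺ N∈ a∈ = ∈-restrict⁺ G (raise-⊆-edges N∈ (lift-∈-raise a∈)) (lift-∈-raise a∈)

  lift-∈-extend⁻ : ∀ {N a} → lift a ∈ extend N → a ∈ N
  lift-∈-extend⁻ {a = a} a∈ with ∈-raise⁻ (proj₂ (∈-restrict⁻ G a∈))
  ... | inj₁ (b , b∈ , eq) = subst (_∈ _) (sym (lift-injective eq)) b∈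
  ... | inj₂ (eq , _)      = ⊥-elim (x∉lift a (subst (Inc x) (sym eq) x∈xvEdge))

  extend-injective : ∀ {N N′} → N ∈ maximalMatchings G⁻ → N′ ∈ maximalMatchings G⁻ →
                     extend N ≡ extend N′ → N ≡ N′
  extend-injective N∈ N′∈ eq =
    subsets-ext (edges-Unique G⁻)
      (proj₁ (∈-maximalMatchings⁻ G⁻ N∈)) (proj₁ (∈-maximalMatchings⁻ G⁻ N′∈))
      (λ a∈ → lift-∈-extend⁻ (subst (_ ∈_) eq (lift-∈-extend⁺ N∈ a∈)))
      (λ a∈ → lift-∈-extend⁻ (subst (_ ∈_) (sym eq) (lift-∈-extend⁺ N′∈ a∈)))

  -- Otherwise v is uncovered by N, and then N would not dominate the edge wv of G - x.
  extend-misses : ∀ {M N w} → xvEdge ∈ M → adj G v w ≡ true → ¬ Covered w M →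
                  N ∈ maximalMatchings G⁻ → extend N ≢ M
  extend-misses {M} {N} {w} xv∈M vw w-free N∈ refl
    with ∈-raise⁻ (proj₂ (∈-restrict⁻ G xv∈M))
  ... | inj₁ (a , _ , eq) = x∉lift a (subst (Inc x) eq x∈xvEdge)
  ... | inj₂ (_ , v-free) = v-free v-covered
    where
    wv∈edges : edgeBetween w v ∈ edges G
    wv∈edges = edgeBetween-∈-edges G (adj-sym G vw)
    w∈wv : Inc w (edgeBetween w v)
    w∈wv = from (Inc-edgeBetween w v) (inj₁ refl)
    x∉wv : ¬ Inc x (edgeBetween w v)
    x∉wv x∈wv with to (Inc-edgeBetween w v) x∈wv
    ... | inj₁ refl = w-free (xvEdge , xv∈M , x∈xvEdge)
    ... | inj₂ refl = adj⇒≢ G xv refl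
    v-covered : Covered v (map lift N)
    v-covered with unlift wv∈edges x∉wv
    ... | e′ , e′∈ , e′↦wv with proj₂ (proj₂ (∈-maximalMatchings⁻ G⁻ N∈)) e′∈
    ...   | inj₁ e′∈N =
      ⊥-elim (w-free (lift e′ , lift-∈-extend⁺ N∈ e′∈N , subst (Inc w) (sym e′↦wv) w∈wv))
    ...   | inj₂ (g , g∈N , s) with Share-lift⁺ s
    ...     | c , c∈e′ , c∈g with to (Inc-edgeBetween w v) (subst (Inc c) e′↦wv c∈e′)
    ...       | inj₁ refl = ⊥-elim (w-free (lift g , lift-∈-extend⁺ N∈ g∈N , c∈g))
    ...       | inj₂ refl = lift g , ∈-map⁺ lift g∈N , c∈g

  uncovered-neighbour⇒Ψ-delete<Ψ : ∀ {M w} → M ∈ maximalMatchings G → xvEdge ∈ M →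
                                   adj G v w ≡ true → ¬ Covered w M → Ψ G⁻ < Ψ G
  uncovered-neighbour⇒Ψ-delete<Ψ {M} M∈ xv∈M vw w-free =
    subst (_≤ Ψ G) (cong suc (Listₚ.length-map extend (maximalMatchings G⁻)))
      (Unique⇒length≤ (All.tabulate M-new ∷ map-Unique extend (maximalMatchings-Unique G⁻) extend-injective)
                       candidates⊆)
    where
    M-new : ∀ {M′} → M′ ∈ map extend (maximalMatchings G⁻) → M ≢ M′
    M-new M′∈ with ∈-map⁻ extend M′∈
    ... | N , N∈ , refl = extend-misses xv∈M vw w-free N∈ ∘ sym
    candidates⊆ : (M ∷ map extend (maximalMatchings G⁻)) ⊆ maximalMatchings G
    candidates⊆ (here refl) = M∈
    candidates⊆ (there M′∈) with ∈-map⁻ extend M′∈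
    ... | N , N∈ , refl = extend-∈ N∈

  -- The greedy extension of M₀ leaves w uncovered: an edge at w meets the M₀-edge covering its
  -- other end.
  blocked-neighbour⇒Ψ-delete<Ψ : ∀ {M₀ w} → M₀ ⊆ edges G → Matching M₀ → xvEdge ∈ M₀ →
                                 adj G v w ≡ true → ¬ Covered w M₀ →
                                 (∀ {z} → adj G w z ≡ true → Covered z M₀) → Ψ G⁻ < Ψ G
  blocked-neighbour⇒Ψ-delete<Ψ {M₀} {w} M₀⊆G M₀-matching xv∈M₀ vw w-free nbrs-covered =
    uncovered-neighbour⇒Ψ-delete<Ψ (extendMaximal-∈ G M₀⊆G M₀-matching) (extendMaximal-⊇ G M₀⊆G xv∈M₀)
                                   vw still-free
    where
    still-free : ¬ Covered w (extendMaximal G M₀)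
    still-free (g , g∈ , w∈g) with ∈-extendMaximal⁻ G g∈
    ... | inj₁ g∈M₀ = w-free (g , g∈M₀ , w∈g)
    ... | inj₂ g-free with other-end G (proj₁ (∈-restrict⁻ G g∈)) w∈g
    ...   | z , wz , z∈g with nbrs-covered wz
    ...     | f , f∈M₀ , z∈f = g-free f∈M₀ (z , z∈g , z∈f)

module _ {m} (G : Graph m) where

  neighbours : Fin m → List (Fin m)
  neighbours u = filterᵇ (adj G u) (allFin m)

  ∈-neighbours⁺ : ∀ {u z} → adj G u z ≡ true → z ∈ neighbours u
  ∈-neighbours⁺ {u} uz = ∈-filter⁺ (T? ∘ adj G u) (∈-allFin _) (from T-≡ uz)

  ∈-neighbours⁻ : ∀ {u z} → z ∈ neighbours u → adj G u z ≡ true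
  ∈-neighbours⁻ {u} z∈ = to T-≡ (proj₂ (∈-filter⁻ (T? ∘ adj G u) {xs = allFin m} z∈))

  leaf-neighbour-unique : ∀ {u a b} → IsLeaf G u → adj G u a ≡ true → adj G u b ≡ true → a ≡ b
  leaf-neighbour-unique u-leaf ua ub = length≡1⇒≡ u-leaf (∈-neighbours⁺ ua) (∈-neighbours⁺ ub)

  leaf-neighbour : ∀ {u} → IsLeaf G u → ∃ λ z → adj G u z ≡ true
  leaf-neighbour u-leaf = Product.map₂ ∈-neighbours⁻ (length≡1⇒∃∈ u-leaf)

  other-neighbour : ∀ {u a} → ¬ IsLeaf G u → adj G u a ≡ true →
                    ∀ w → ∃ λ z → adj G u z ≡ true × z ≢ w
  other-neighbour {u} ¬leaf ua w =
    Product.map₂ (Product.map₁ ∈-neighbours⁻)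
      (length≢1⇒∃∈≢ (Uniqueₚ.filter⁺ (T? ∘ adj G u) (Uniqueₚ.allFin⁺ m)) (∈-neighbours⁺ ua) ¬leaf w)

  -- A neighbour of u other than y if u is not a leaf; u itself otherwise.
  otherNeighbour : Fin m → Fin m → Fin m
  otherNeighbour u y with Finₚ.any? (λ z → (adj G u z Bool.≟ true) Dec.×-dec Dec.¬? (z ≟ y))
  ... | yes (z , _) = z
  ... | no _        = u

  otherNeighbour-spec : ∀ {u y} → ¬ IsLeaf G u → adj G u y ≡ true →
                        adj G u (otherNeighbour u y) ≡ true × otherNeighbour u y ≢ y
  otherNeighbour-spec {u} {y} ¬leaf uy
    with Finₚ.any? (λ z → (adj G u z Bool.≟ true) Dec.×-dec Dec.¬? (z ≟ y))
  ... | yes (_ , spec) = spec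
  ... | no none        = ⊥-elim (none (other-neighbour ¬leaf uy y))

  Path-++⁻ˡ : ∀ xs {ys} → Path G (xs ++ ys) → Path G xs
  Path-++⁻ˡ []           _              = _
  Path-++⁻ˡ (x ∷ [])     _              = _
  Path-++⁻ˡ (x ∷ y ∷ xs) (xy , path) = xy , Path-++⁻ˡ (y ∷ xs) path

  closeCycle : ∀ a b xs {y} → Unique (a ∷ b ∷ xs ++ [ y ]) → Path G (a ∷ b ∷ xs ++ [ y ]) →
               adj G y a ≡ true → IsCycle G (a ∷ b ∷ xs ++ [ y ])
  closeCycle a b xs {y} unique path ya rewrite last-∷ʳ a (b ∷ xs) y =
    s≤s (s≤s (subst (1 ≤_) (sym (Listₚ.length-++ xs)) (ℕₚ.m≤n+m 1 (length xs)))) , unique , path , ya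

  module _ (acyclic : Acyclic G) where

    no-triangle : ∀ {a b c} → adj G a b ≡ true → adj G b c ≡ true → adj G c a ≡ true → ⊥
    no-triangle {a} {b} {c} ab bc ca =
      acyclic _ (closeCycle a b []
                  ((adj⇒≢ G ab All.∷ adj⇒≢ G ca ∘ sym All.∷ All.[]) ∷ (adj⇒≢ G bc All.∷ All.[]) ∷ All.[] ∷ [])
                  (ab , bc , _) ca)

    no-square : ∀ {a b c d} → adj G a b ≡ true → adj G b c ≡ true → adj G c d ≡ true → adj G d a ≡ true →
                a ≢ c → b ≢ d → ⊥
    no-square {a} {b} {c} {d} ab bc cd da a≢c b≢d =
      acyclic _ (closeCycle a b (c ∷ [])
                  ((adj⇒≢ G ab All.∷ a≢c All.∷ adj⇒≢ G da ∘ sym All.∷ All.[])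
                   ∷ (adj⇒≢ G bc All.∷ b≢d All.∷ All.[]) ∷ (adj⇒≢ G cd All.∷ All.[]) ∷ All.[] ∷ [])
                  (ab , bc , cd , _) da)

    -- Without leaves, a simple path can always be prolonged at its head, since closing it up would
    -- give a cycle.
    module _ (no-leaf : ∀ u → ¬ IsLeaf G u) where

      prolong : ∀ {a b rest} → Unique (a ∷ b ∷ rest) → Path G (a ∷ b ∷ rest) →
                ∃ λ y → Unique (y ∷ a ∷ b ∷ rest) × Path G (y ∷ a ∷ b ∷ rest)
      prolong {a} {b} {rest} unique path with other-neighbour (no-leaf a) (proj₁ path) b
      ... | y , ay , y≢b with Any.any? (y ≟_) (a ∷ b ∷ rest)
      ...   | no y∉ =
        y , All.tabulate (λ z∈ y≡z → y∉ (subst (_∈ _) (sym y≡z) z∈)) ∷ unique , adj-sym G ay , path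
      ...   | yes (here refl) = ⊥-elim (adj⇒≢ G ay refl)
      ...   | yes (there (here refl)) = ⊥-elim (y≢b refl)
      ...   | yes (there (there y∈rest)) with ∈-∃++ y∈rest
      ...     | pre , post , refl =
        ⊥-elim (acyclic _ (closeCycle a b pre
                             (Unique-++⁻ˡ (a ∷ b ∷ pre ++ [ y ]) (subst Unique split unique))
                             (Path-++⁻ˡ (a ∷ b ∷ pre ++ [ y ]) (subst (Path G) split path))
                             (adj-sym G ay)))
        where
        split : a ∷ b ∷ pre ++ [ y ] ++ post ≡ (a ∷ b ∷ pre ++ [ y ]) ++ post
        split = cong (λ zs → a ∷ b ∷ zs) (sym (Listₚ.++-assoc pre [ y ] post))

      no-long-paths : ∀ k {a b rest} → Unique (a ∷ b ∷ rest) → Path G (a ∷ b ∷ rest) →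
                      m ≤ length rest + k → ⊥
      no-long-paths zero {rest = rest} unique _ m≤ =
        ℕₚ.<-irrefl refl (ℕₚ.≤-trans (ℕₚ.n≤1+n _) (begin
          suc (suc (length rest)) ≤⟨ Unique⇒length≤ unique (λ _ → ∈-allFin _) ⟩
          length (allFin m)       ≡⟨ Listₚ.length-tabulate id ⟩
          m                       ≤⟨ m≤ ⟩
          length rest + 0         ≡⟨ ℕₚ.+-identityʳ _ ⟩
          length rest             ∎))
        where open ℕₚ.≤-Reasoning
      no-long-paths (suc k) {rest = rest} unique path m≤ with prolong unique path
      ... | y , unique′ , path′ =
        no-long-paths k unique′ path′ (subst (m ≤_) (ℕₚ.+-suc (length rest) k) m≤)

    leaf-exists : ∀ {a b} → adj G a b ≡ true → ∃ λ u → IsLeaf G u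
    leaf-exists ab with Finₚ.any? (λ u → degree G u ℕ.≟ 1)
    ... | yes found = found
    ... | no none = ⊥-elim (no-long-paths (λ u leaf → none (u , leaf)) m
                              ((adj⇒≢ G ab All.∷ All.[]) ∷ All.[] ∷ []) (ab , _) ℕₚ.≤-refl)

-- The matching M₀
-- consists of xv and an edge leading away from y at each other neighbour of y; acyclicity is what
-- keeps these edges disjoint.

module _ {n} {G : Graph (suc n)} (acyclic : Acyclic G) {x v y : Fin (suc n)}
  (x-leaf : IsLeaf G x) (xv : adj G x v ≡ true) (vy : adj G v y ≡ true) (y≢x : y ≢ x)
  (y-unsupported : ∀ {u} → adj G y u ≡ true → ¬ IsLeaf G u) where

  private
    open LeafDeletion G xv (λ xu → leaf-neighbour-unique G x-leaf xu xv)

    y≢v : y ≢ v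
    y≢v = adj⇒≢ G vy ∘ sym

    away? : Decidable (λ u → adj G y u ≡ true × u ≢ v)
    away? u = (adj G y u Bool.≟ true) Dec.×-dec Dec.¬? (u ≟ v)

    others : List (Fin (suc n))
    others = filter away? (allFin _)

    ∈-others⁻ : ∀ {u} → u ∈ others → adj G y u ≡ true × u ≢ v
    ∈-others⁻ = proj₂ ∘ ∈-filter⁻ away? {xs = allFin _}

    far : Fin (suc n) → Fin (suc n)
    far u = otherNeighbour G u y

    far-spec : ∀ {u} → u ∈ others → adj G u (far u) ≡ true × far u ≢ y
    far-spec u∈ = let yu , _ = ∈-others⁻ u∈ in otherNeighbour-spec G (y-unsupported yu) (adj-sym G yu)

    edgeAway : Fin (suc n) → Edge (suc n)
    edgeAway u = edgeBetween u (far u)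

    M₀ : List (Edge (suc n))
    M₀ = xvEdge ∷ map edgeAway others

    ∈-M₀⁻ : ∀ {e} → e ∈ M₀ → e ≡ xvEdge ⊎ ∃ λ u → u ∈ others × e ≡ edgeAway u
    ∈-M₀⁻ (here refl) = inj₁ refl
    ∈-M₀⁻ (there e∈)  = inj₂ (∈-map⁻ edgeAway e∈)

    xvEdge-edgeAway-disjoint : ∀ {u} → u ∈ others → ¬ Share xvEdge (edgeAway u)
    xvEdge-edgeAway-disjoint {u} u∈ (z , z∈xv , z∈e)
      with ∈-others⁻ u∈ | far-spec u∈
         | to (Inc-edgeBetween x v) z∈xv | to (Inc-edgeBetween u (far u)) z∈e
    ... | yu , _ | _ | inj₁ refl | inj₁ refl = y≢v (leaf-neighbour-unique G x-leaf (adj-sym G yu) xv)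
    ... | _ , u≢v | u-far , _ | inj₁ refl | inj₂ refl =
      u≢v (leaf-neighbour-unique G x-leaf (adj-sym G u-far) xv)
    ... | _ , u≢v | _ | inj₂ refl | inj₁ refl = u≢v refl
    ... | yu , _ | u-far , _ | inj₂ refl | inj₂ refl = no-triangle G acyclic yu u-far vy

    edgeAway-disjoint : ∀ {u u′} → u ∈ others → u′ ∈ others →
                        Share (edgeAway u) (edgeAway u′) → u ≡ u′
    edgeAway-disjoint {u} {u′} u∈ u′∈ (z , z∈e , z∈e′) with u ≟ u′
    ... | yes u≡u′ = u≡u′
    ... | no u≢u′ with ∈-others⁻ u∈ | ∈-others⁻ u′∈ | far-spec u∈ | far-spec u′∈
                     | to (Inc-edgeBetween u (far u)) z∈e | to (Inc-edgeBetween u′ (far u′)) z∈e′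
    ...   | _ | _ | _ | _ | inj₁ refl | inj₁ refl = ⊥-elim (u≢u′ refl)
    ...   | yu , _ | yu′ , _ | _ | u′-far , _ | inj₁ refl | inj₂ u≡far′ =
      ⊥-elim (no-triangle G acyclic yu′ (subst (λ t → adj G u′ t ≡ true) (sym u≡far′) u′-far)
                                        (adj-sym G yu))
    ...   | yu , _ | yu′ , _ | u-far , _ | _ | inj₂ refl | inj₁ refl =
      ⊥-elim (no-triangle G acyclic yu u-far (adj-sym G yu′))
    ...   | yu , _ | yu′ , _ | u-far , far≢y | u′-far , _ | inj₂ refl | inj₂ far≡far′ =
      ⊥-elim (no-square G acyclic yu u-far
                (adj-sym G (subst (λ t → adj G u′ t ≡ true) (sym far≡far′) u′-far))
                (adj-sym G yu′) (far≢y ∘ sym) u≢u′)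

    M₀-matching : Matching M₀
    M₀-matching e∈ f∈ s with ∈-M₀⁻ e∈ | ∈-M₀⁻ f∈
    ... | inj₁ refl | inj₁ refl = refl
    ... | inj₁ refl | inj₂ (u , u∈ , refl) = ⊥-elim (xvEdge-edgeAway-disjoint u∈ s)
    ... | inj₂ (u , u∈ , refl) | inj₁ refl = ⊥-elim (xvEdge-edgeAway-disjoint u∈ (Share-sym s))
    ... | inj₂ (u , u∈ , refl) | inj₂ (u′ , u′∈ , refl) = cong edgeAway (edgeAway-disjoint u∈ u′∈ s)

    M₀⊆edges : M₀ ⊆ edges G
    M₀⊆edges e∈ with ∈-M₀⁻ e∈
    ... | inj₁ refl = xvEdge-∈-edges
    ... | inj₂ (u , u∈ , refl) = edgeBetween-∈-edges G (proj₁ (far-spec u∈))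

    y-free : ¬ Covered y M₀
    y-free (e , e∈ , y∈e) with ∈-M₀⁻ e∈
    ... | inj₁ refl = [ y≢x , y≢v ]′ (to (Inc-edgeBetween x v) y∈e)
    ... | inj₂ (u , u∈ , refl) =
      [ adj⇒≢ G (proj₁ (∈-others⁻ u∈)) , proj₂ (far-spec u∈) ∘ sym ]′
        (to (Inc-edgeBetween u (far u)) y∈e)

    y-neighbours-covered : ∀ {z} → adj G y z ≡ true → Covered z M₀
    y-neighbours-covered {z} yz with z ≟ v
    ... | yes refl = xvEdge , here refl , v∈xvEdge
    ... | no z≢v = edgeAway z , there (∈-map⁺ edgeAway (∈-filter⁺ away? (∈-allFin z) (yz , z≢v))) ,
                   from (Inc-edgeBetween z (far z)) (inj₁ refl)

  unsupported-neighbour⇒Ψ-delete<Ψ : Ψ (delete G x) < Ψ G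
  unsupported-neighbour⇒Ψ-delete<Ψ =
    blocked-neighbour⇒Ψ-delete<Ψ M₀⊆edges M₀-matching (here refl) vy y-free y-neighbours-covered

-- Fixed-point-free involutions

module _ {V} (p : Fin V → Fin V) (p-involutive : ∀ u → p (p u) ≡ u) (p-fixfree : ∀ u → p u ≢ u) where

  private
    p-injective : ∀ {a b} → p a ≡ p b → a ≡ b
    p-injective {a} {b} pa≡pb = trans (sym (p-involutive a)) (trans (cong p pa≡pb) (p-involutive b))

    count : ∀ {P : Fin V → Set} → Decidable P → ℕ
    count P? = length (filter P? (allFin V))

    count-mono : ∀ {P Q : Fin V → Set} (P? : Decidable P) (Q? : Decidable Q) →
                 (∀ {u} → P u → Q (p u)) → count P? ≤ count Q?
    count-mono P? Q? P⇒Q = subst (_≤ count Q?) (Listₚ.length-map p (filter P? (allFin V)))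
      (Unique⇒length≤ (Uniqueₚ.map⁺ p-injective (Uniqueₚ.filter⁺ P? (Uniqueₚ.allFin⁺ V))) image⊆)
      where
      image⊆ : map p (filter P? (allFin V)) ⊆ filter Q? (allFin V)
      image⊆ z∈ with ∈-map⁻ p z∈
      ... | u , u∈ , refl = ∈-filter⁺ Q? (∈-allFin _) (P⇒Q (proj₂ (∈-filter⁻ P? {xs = allFin V} u∈)))

    rises? : Decidable (λ u → u Fin.< p u)
    rises? u = u Finₚ.<? p u

    rise⇒fall : ∀ {u} → u Fin.< p u → ¬ p u Fin.< p (p u)
    rise⇒fall {u} u<pu pu<ppu = Finₚ.<-asym u<pu (subst (p u Fin.<_) (p-involutive u) pu<ppu)

    fall⇒rise : ∀ {u} → ¬ u Fin.< p u → p u Fin.< p (p u)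
    fall⇒rise {u} u≮pu =
      subst (p u Fin.<_) (sym (p-involutive u)) (Finₚ.≤∧≢⇒< (ℕₚ.≮⇒≥ u≮pu) (p-fixfree u))

  -- p pairs off the points that it moves up with those that it moves down.
  involution⇒even : 2 ∣ V
  involution⇒even = divides (count rises?) (begin
    V                                      ≡⟨ Listₚ.length-tabulate id ⟨
    length (allFin V)                      ≡⟨ length-filter-∁ rises? (allFin V) ⟩
    count rises? + count (∁? rises?)       ≡⟨ cong (count rises? +_) falls≡rises ⟩
    count rises? + count rises?            ≡⟨ cong (count rises? +_) (ℕₚ.+-identityʳ (count rises?)) ⟨
    2 ℕ.* count rises?                     ≡⟨ ℕₚ.*-comm 2 (count rises?) ⟩
    count rises? ℕ.* 2                     ∎)
    where
    open ≡-Reasoning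
    falls≡rises : count (∁? rises?) ≡ count rises?
    falls≡rises = ℕₚ.≤-antisym (count-mono (∁? rises?) rises? fall⇒rise)
                               (count-mono rises? (∁? rises?) rise⇒fall)

-- Trees in which deleting any leaf preserves Ψ

module Ψ-Stable {k} (G : Graph (suc (suc k))) (tree : IsTree G)
  (Ψ-stable : ∀ x → IsLeaf G x → Ψ G ≡ Ψ (delete G x)) where

  IsSupport : Fin (suc (suc k)) → Set
  IsSupport u = ∃ λ z → adj G u z ≡ true × IsLeaf G z

  neighbour-of-support : ∀ {x v y} → IsLeaf G x → adj G x v ≡ true → adj G v y ≡ true → y ≢ x →
                         IsSupport y
  neighbour-of-support {x} {y = y} x-leaf xv vy y≢x
    with Finₚ.any? (λ z → (adj G y z Bool.≟ true) Dec.×-dec (degree G z ℕ.≟ 1))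
  ... | yes supported = supported
  ... | no unsupported = ⊥-elim (ℕₚ.<-irrefl (sym (Ψ-stable x x-leaf)) Ψ-drops)
    where
    Ψ-drops : Ψ (delete G x) < Ψ G
    Ψ-drops = unsupported-neighbour⇒Ψ-delete<Ψ (proj₂ tree) x-leaf xv vy y≢x
                                              (λ yu u-leaf → unsupported (_ , yu , u-leaf))

  support-leaf-unique : ∀ {x v y} → IsLeaf G x → adj G x v ≡ true → adj G v y ≡ true → IsLeaf G y →
                        y ≡ x
  support-leaf-unique {x} {y = y} x-leaf xv vy y-leaf with y ≟ x
  ... | yes y≡x = y≡x
  ... | no y≢x with neighbour-of-support x-leaf xv vy y≢x
  ...   | z , yz , z-leaf with leaf-neighbour-unique G y-leaf yz (adj-sym G vy)
  ...     | refl = sym (leaf-neighbour-unique G z-leaf (adj-sym G xv) vy)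

  LeafOrSupport : Fin (suc (suc k)) → Set
  LeafOrSupport u = IsLeaf G u ⊎ IsSupport u

  LeafOrSupport-step : ∀ {a b} → LeafOrSupport a → adj G a b ≡ true → LeafOrSupport b
  LeafOrSupport-step {a} (inj₁ a-leaf) ab = inj₂ (a , adj-sym G ab , a-leaf)
  LeafOrSupport-step {b = b} (inj₂ (x , ax , x-leaf)) ab with b ≟ x
  ... | yes refl = inj₁ x-leaf
  ... | no b≢x   = inj₂ (neighbour-of-support x-leaf (adj-sym G ax) ab b≢x)

  LeafOrSupport-walk : ∀ {a b} → Walk G a b → LeafOrSupport a → LeafOrSupport b
  LeafOrSupport-walk here         a-ok = a-ok
  LeafOrSupport-walk (step ab ws) a-ok = LeafOrSupport-walk ws (LeafOrSupport-step a-ok ab)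

  leafOrSupport : ∀ u → LeafOrSupport u
  leafOrSupport u with proj₁ tree Fin.zero (Fin.suc Fin.zero)
  ... | step ab _ with leaf-exists G (proj₂ tree) ab
  ...   | ℓ , ℓ-leaf = LeafOrSupport-walk (proj₁ tree ℓ u) (inj₁ ℓ-leaf)

  Partners : Fin (suc (suc k)) → Fin (suc (suc k)) → Set
  Partners u z = adj G u z ≡ true × (IsLeaf G u ⊎ IsLeaf G z)

  partner-exists : ∀ u → ∃ (Partners u)
  partner-exists u with leafOrSupport u
  ... | inj₁ u-leaf = let z , uz = leaf-neighbour G u-leaf in z , uz , inj₁ u-leaf
  ... | inj₂ (z , uz , z-leaf) = z , uz , inj₂ z-leaf

  Partners-unique : ∀ {u z z′} → Partners u z → Partners u z′ → z ≡ z′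
  Partners-unique (uz , inj₁ u-leaf) (uz′ , _) = leaf-neighbour-unique G u-leaf uz uz′
  Partners-unique (uz , _) (uz′ , inj₁ u-leaf) = leaf-neighbour-unique G u-leaf uz uz′
  Partners-unique (uz , inj₂ z-leaf) (uz′ , inj₂ z′-leaf) =
    sym (support-leaf-unique z-leaf (adj-sym G uz) uz′ z′-leaf)

  Partners-sym : ∀ {u z} → Partners u z → Partners z u
  Partners-sym (uz , leaf) = adj-sym G uz , Sum.swap leaf

  partner : Fin (suc (suc k)) → Fin (suc (suc k))
  partner u = proj₁ (partner-exists u)

  partner-involutive : ∀ u → partner (partner u) ≡ u
  partner-involutive u =
    Partners-unique (proj₂ (partner-exists (partner u))) (Partners-sym (proj₂ (partner-exists u)))

  partner-fixfree : ∀ u → partner u ≢ u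
  partner-fixfree u = adj⇒≢ G (proj₁ (proj₂ (partner-exists u))) ∘ sym

  order-even : 2 ∣ suc (suc k)
  order-even = involution⇒even partner partner-involutive partner-fixfree

-- The bound on the order only excludes the one-vertex tree, for which the hypothesis is vacuous.
theorem3p6 : (n : ℕ) (T : Graph (suc n)) → IsTree T → 3 ≤ suc n
           → (∀ (x : Fin (suc n)) → IsLeaf T x → Ψ T ≡ Ψ (delete T x))
           → 2 ∣ suc n
theorem3p6 zero    _ _    (s≤s ()) _
theorem3p6 (suc k) T tree _        Ψ-stable = Ψ-Stable.order-even T tree Ψ-stable
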